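{- Let $r,n$ be positive integers with $n\geq r$, let $s,d\in\mathbb{N}$ with $0\leq d\leq\lfloor s/r\rfloor$, and let $\mathbf a\in\mathbb{N}^n$ with $|\mathbf a|=s-rd$. Then $K(r,n,\mathbf a,d)=L(r,n,\mathbf a,d)$, and this set is $r$-wise $s$-union.
   Context: $\mathbb{N}=\{0,1,2,\ldots\}$; $|\mathbf a|=\sum_i a_i$; $\mathbf 1=(1,\ldots,1)$. The join of vectors is their componentwise maximum; a family $A\subset\mathbb{N}^n$ is $r$-wise $s$-union if the join of any $r$ vectors of $A$ (not necessarily distinct) has weight at most $s$. Write $\mathbf a\prec\mathbf b$ if $a_i\leq b_i$ for all $i$; $\mathcal{D}(\mathbf a)=\{\mathbf c\in\mathbb{N}^n:\mathbf c\prec\mathbf a\}$, $\mathcal{D}(B)=\bigcup_{\mathbf a\in B}\mathcal{D}(\mathbf a)$; $\mathcal{U}(\mathbf a,d)=\{\mathbf a+\boldsymbol\epsilon:\boldsymbol\epsilon\in\mathbb{N}^n,|\boldsymbol\epsilon|=d\}$. With $u=n-r+1$, \[ K(r,n,\mathbf a,d)=\bigcup_{i=0}^{\lfloor d/u\rfloor}\mathcal{D}(\mathcal{U}(\mathbf a+i\mathbf 1,d-ui)). \] $L(r,n,\mathbf a,d)$ is the set of $\mathbf x\in\mathbb{N}^n$ satisfying $\sum_{i\in I}x_i\leq\sum_{i\in I}a_i+d$ for every $I\subset[n]$ with $1\leq|I|\leq n-r+1$ (the integer points of the polytope defined by $x_i\geq 0$ and these inequalities). -}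

module Defs where

open import Data.Nat using (ℕ; zero; suc; _+_; _*_; _∸_; _≤_; _⊔_; NonZero)
open import Data.Nat.DivMod using (_/_)
open import Data.Fin using (Fin; zero; suc)
open import Data.Fin.Subset using (Subset; ∣_∣)
open import Data.Vec using (lookup)
open import Data.Bool using (if_then_else_)
open import Data.Product using (Σ; _×_)
open import Relation.Binary.PropositionalEquality using (_≡_)

Vecℕ : ℕ → Set
Vecℕ n = Fin n → ℕ

wt : ∀ {n} → Vecℕ n → ℕ
wt {zero}  a = 0
wt {suc n} a = a zero + wt (λ i → a (suc i))

maxF : ∀ {r} → (Fin r → ℕ) → ℕ
maxF {zero}  f = 0
maxF {suc r} f = f zero ⊔ maxF (λ j → f (suc j))

join : ∀ {r n} → (Fin r → Vecℕ n) → Vecℕ n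
join f i = maxF (λ j → f j i)

Family : ℕ → Set₁
Family n = Vecℕ n → Set

-- r-wise s-union: the join of any r (not necessarily distinct) members has weight ≤ s
RwiseSUnion : ∀ {n} → ℕ → ℕ → Family n → Set
RwiseSUnion {n} r s A = (f : Fin r → Vecℕ n) → (∀ j → A (f j)) → wt (join f) ≤ s

_≺_ : ∀ {n} → Vecℕ n → Vecℕ n → Set
a ≺ b = ∀ i → a i ≤ b i

𝒟 : ∀ {n} → Family n → Family n
𝒟 B c = Σ _ λ b → B b × c ≺ b

𝒰 : ∀ {n} → Vecℕ n → ℕ → Family n
𝒰 a d x = Σ _ λ ε → wt ε ≡ d × (∀ i → x i ≡ a i + ε i)

K : (r n : ℕ) → Vecℕ n → ℕ → Family n
K r n a d x = Σ ℕ λ i → i ≤ d / u × 𝒟 (𝒰 (λ j → a j + i) (d ∸ u * i)) x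
  where u = suc (n ∸ r)

sumOn : ∀ {n} → Subset n → Vecℕ n → ℕ
sumOn I x = wt (λ i → if lookup I i then x i else 0)

L : (r n : ℕ) → Vecℕ n → ℕ → Family n
L r n a d x = (I : Subset n) → 1 ≤ ∣ I ∣ → ∣ I ∣ ≤ n ∸ r + 1 → sumOn I x ≤ sumOn I a + d

module Submission where

-- Put u = n − r + 1. A vector c is an excess profile of level i if c = i·𝟏 + ε
-- with u·i ≤ d and |ε| = d − u·i; unfolding the definition, K(r,n,a,d) is the set
-- of x with x ≺ a + c for some profile c (K-profile, profile-K).
-- * K ⊆ L: over any index set I with |I| ≤ u a profile sums to at most
--   |I|·i + |ε| ≤ d.
-- * L ⊆ K: with y = x ∸ a, the constraints of L bound the top-u sum of y by d.
--   Subtracting 1 from every coordinate while y has at least u nonzero entries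
--   lowers the top-u sum by at least u, which yields a level i with
--   u·i + |y ∸ i| ≤ d (topSum⇒level); padding y ∸ i gives a profile above x ∸ a.
-- * r-wise s-union: the join of x_1,…,x_r ∈ K lies below a + C, C_k = max_j c_j,k.
--   Assign every coordinate to a profile attaining the maximum; a profile owning
--   t coordinates contributes at most min(t, 1 + (t ∸ u))·d, and since the t_j add
--   up to n = (u − 1) + r these multipliers add up to at most r.

open import Defs
open import Data.Nat using (ℕ; zero; suc; _+_; _*_; _∸_; _≤_; _<_; _⊔_; _⊓_; z≤n; s≤s; _≤?_; NonZero; _/_; _≟_; ≢-nonZero⁻¹)
open import Data.Nat.Properties
open import Data.Nat.DivMod using (m/n*n≤m; m*n/n≡m; /-monoˡ-≤)
open import Data.Nat.Induction using (<-rec)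
open import Algebra.Properties.CommutativeSemigroup +-commutativeSemigroup using (interchange; x∙yz≈y∙xz; xy∙z≈xz∙y)
open import Data.Fin using (Fin; zero; suc)
open import Data.Fin.Properties using (any?)
open import Data.Fin.Subset using (Subset; ∣_∣; ⊥)
open import Data.Fin.Subset.Properties using (∣⊥∣≡0)
open import Data.Vec using ([]; _∷_; lookup)
open import Data.Vec.Properties using (lookup-replicate)
open import Data.Bool using (true; false)
open import Data.Product using (Σ; _×_; _,_; proj₁; proj₂)
open import Relation.Binary.PropositionalEquality
open import Relation.Nullary using (Dec; yes; no; ¬_; contradiction)

tl : ∀ {n} → Vecℕ (suc n) → Vecℕ n
tl y k = y (suc k)

wt-cong : ∀ {n} {f g : Vecℕ n} → (∀ k → f k ≡ g k) → wt f ≡ wt g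
wt-cong {zero}  h = refl
wt-cong {suc n} h = cong₂ _+_ (h zero) (wt-cong (λ k → h (suc k)))

wt-mono : ∀ {n} {f g : Vecℕ n} → f ≺ g → wt f ≤ wt g
wt-mono {zero}  h = z≤n
wt-mono {suc n} h = +-mono-≤ (h zero) (wt-mono (λ k → h (suc k)))

wt-+ : ∀ {n} (f g : Vecℕ n) → wt (λ k → f k + g k) ≡ wt f + wt g
wt-+ {zero}  f g = refl
wt-+ {suc n} f g = trans (cong (f zero + g zero +_) (wt-+ (tl f) (tl g)))
                         (interchange (f zero) (g zero) (wt (tl f)) (wt (tl g)))

wt-*ʳ : ∀ {n} (f : Vecℕ n) c → wt (λ k → f k * c) ≡ wt f * c
wt-*ʳ {zero}  f c = refl
wt-*ʳ {suc n} f c = trans (cong (f zero * c +_) (wt-*ʳ (tl f) c))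
                          (sym (*-distribʳ-+ c (f zero) (wt (tl f))))

wt-const : ∀ n c → wt {n} (λ _ → c) ≡ n * c
wt-const zero    c = refl
wt-const (suc n) c = cong (c +_) (wt-const n c)

entry≤wt : ∀ {n} (f : Vecℕ n) k → f k ≤ wt f
entry≤wt f zero    = m≤m+n _ _
entry≤wt f (suc k) = ≤-trans (entry≤wt (tl f) k) (m≤n+m _ (f zero))

wt-swap : ∀ {m n} (F : Fin m → Vecℕ n) →
          wt (λ j → wt (F j)) ≡ wt (λ k → wt (λ j → F j k))
wt-swap {zero}  {n} F = sym (trans (wt-const n 0) (*-zeroʳ n))
wt-swap {suc m} {n} F = begin
    wt (F zero) + wt (λ j → wt (F (suc j)))
  ≡⟨ cong (wt (F zero) +_) (wt-swap (λ j → F (suc j))) ⟩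
    wt (F zero) + wt (λ k → wt (λ j → F (suc j) k))
  ≡⟨ sym (wt-+ (F zero) (λ k → wt (λ j → F (suc j) k))) ⟩
    wt (λ k → F zero k + wt (λ j → F (suc j) k)) ∎
  where open ≡-Reasoning

wt-mono-gap : ∀ {n} (f g : Vecℕ n) k₀ X → f ≺ g → f k₀ + X ≤ g k₀ → wt f + X ≤ wt g
wt-mono-gap f g zero X f≺g gap = begin
    f zero + wt (tl f) + X    ≡⟨ xy∙z≈xz∙y (f zero) (wt (tl f)) X ⟩
    f zero + X + wt (tl f)    ≤⟨ +-mono-≤ gap (wt-mono (λ k → f≺g (suc k))) ⟩
    wt g                      ∎
  where open ≤-Reasoning
wt-mono-gap f g (suc k₀) X f≺g gap = begin
    f zero + wt (tl f) + X    ≡⟨ +-assoc (f zero) _ X ⟩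
    f zero + (wt (tl f) + X)  ≤⟨ +-mono-≤ (f≺g zero) (wt-mono-gap (tl f) (tl g) k₀ X (λ k → f≺g (suc k)) gap) ⟩
    wt g                      ∎
  where open ≤-Reasoning

δ : ∀ {r} → Fin r → Fin r → ℕ
δ zero    zero    = 1
δ zero    (suc _) = 0
δ (suc _) zero    = 0
δ (suc i) (suc j) = δ i j

δ≤1 : ∀ {r} (i j : Fin r) → δ i j ≤ 1
δ≤1 zero    zero    = ≤-refl
δ≤1 zero    (suc j) = z≤n
δ≤1 (suc i) zero    = z≤n
δ≤1 (suc i) (suc j) = δ≤1 i j

wt-δ : ∀ {r} (j₀ : Fin r) (g : Fin r → ℕ) → wt (λ j → δ j₀ j * g j) ≡ g j₀
wt-δ {suc r} zero g = begin
    g zero + 0 + wt {r} (λ _ → 0)  ≡⟨ cong (g zero + 0 +_) (trans (wt-const r 0) (*-zeroʳ r)) ⟩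
    g zero + 0 + 0                 ≡⟨ +-identityʳ _ ⟩
    g zero + 0                     ≡⟨ +-identityʳ _ ⟩
    g zero                         ∎
  where open ≡-Reasoning
wt-δ {suc r} (suc j₀) g = wt-δ j₀ (tl g)

wt-by-owner : ∀ {r n} (own : Fin n → Fin r) (c : Fin r → Vecℕ n) →
              wt (λ k → c (own k) k) ≡ wt (λ j → wt (λ k → δ (own k) j * c j k))
wt-by-owner own c = trans (wt-cong (λ k → sym (wt-δ (own k) (λ j → c j k))))
                          (sym (wt-swap (λ j k → δ (own k) j * c j k)))

owner-counts : ∀ {r n} (own : Fin n → Fin r) → wt (λ j → wt (λ k → δ (own k) j)) ≡ n
owner-counts {n = n} own = begin
    wt (λ j → wt (λ k → δ (own k) j))      ≡⟨ wt-cong (λ j → wt-cong (λ k → sym (*-identityʳ (δ (own k) j)))) ⟩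
    wt (λ j → wt (λ k → δ (own k) j * 1))  ≡⟨ sym (wt-by-owner own (λ _ _ → 1)) ⟩
    wt {n} (λ _ → 1)                       ≡⟨ wt-const n 1 ⟩
    n * 1                                  ≡⟨ *-identityʳ n ⟩
    n                                      ∎
  where open ≡-Reasoning

maxF-lub : ∀ {r} (g : Fin r → ℕ) M → (∀ j → g j ≤ M) → maxF g ≤ M
maxF-lub {zero}  g M h = z≤n
maxF-lub {suc r} g M h = ⊔-lub (h zero) (maxF-lub (tl g) M (λ j → h (suc j)))

argmax : ∀ {r} (g : Fin (suc r) → ℕ) → Σ (Fin (suc r)) λ j → ∀ j' → g j' ≤ g j
argmax {zero}  g = zero , λ { zero → ≤-refl }
argmax {suc r} g with argmax (tl g)
... | j , max with g zero ≤? g (suc j)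
...   | yes g₀≤ = suc j , λ { zero → g₀≤ ; (suc j') → max j' }
...   | no g₀≰  = zero  , λ { zero → ≤-refl ; (suc j') → ≤-trans (max j') (<⇒≤ (≰⇒> g₀≰)) }

sumOn-mono : ∀ {n} (I : Subset n) {f g : Vecℕ n} → f ≺ g → sumOn I f ≤ sumOn I g
sumOn-mono []          h = z≤n
sumOn-mono (true ∷ I)  h = +-mono-≤ (h zero) (sumOn-mono I (λ k → h (suc k)))
sumOn-mono (false ∷ I) h = sumOn-mono I (λ k → h (suc k))

sumOn-+ : ∀ {n} (I : Subset n) (f g : Vecℕ n) →
          sumOn I (λ k → f k + g k) ≡ sumOn I f + sumOn I g
sumOn-+ []          f g = refl
sumOn-+ (true ∷ I)  f g = trans (cong (f zero + g zero +_) (sumOn-+ I (tl f) (tl g)))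
                                (interchange (f zero) (g zero) _ _)
sumOn-+ (false ∷ I) f g = sumOn-+ I (tl f) (tl g)

sumOn-const : ∀ {n} (I : Subset n) c → sumOn I (λ _ → c) ≡ ∣ I ∣ * c
sumOn-const []          c = refl
sumOn-const (true ∷ I)  c = cong (c +_) (sumOn-const I c)
sumOn-const (false ∷ I) c = sumOn-const I c

sumOn≤wt : ∀ {n} (I : Subset n) f → sumOn I f ≤ wt f
sumOn≤wt []          f = z≤n
sumOn≤wt (true ∷ I)  f = +-monoʳ-≤ (f zero) (sumOn≤wt I (tl f))
sumOn≤wt (false ∷ I) f = ≤-trans (sumOn≤wt I (tl f)) (m≤n+m _ (f zero))

sumOn-empty : ∀ {n} (I : Subset n) f → ∣ I ∣ ≡ 0 → sumOn I f ≡ 0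
sumOn-empty []          f h = refl
sumOn-empty (false ∷ I) f h = sumOn-empty I (tl f) h

sumOn-cong : ∀ {n} (I : Subset n) {f g : Vecℕ n} →
             (∀ k → lookup I k ≡ true → f k ≡ g k) → sumOn I f ≡ sumOn I g
sumOn-cong []          h = refl
sumOn-cong (true ∷ I)  h = cong₂ _+_ (h zero refl) (sumOn-cong I (λ k → h (suc k)))
sumOn-cong (false ∷ I) h = sumOn-cong I (λ k → h (suc k))

≤/⇒*≤ : ∀ i d u .{{_ : NonZero u}} → i ≤ d / u → u * i ≤ d
≤/⇒*≤ i d u i≤ = begin
    u * i      ≡⟨ *-comm u i ⟩
    i * u      ≤⟨ *-monoˡ-≤ u i≤ ⟩
    d / u * u  ≤⟨ m/n*n≤m d u ⟩
    d          ∎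
  where open ≤-Reasoning

*≤⇒≤/ : ∀ i d u .{{_ : NonZero u}} → u * i ≤ d → i ≤ d / u
*≤⇒≤/ i d u ui≤d = begin
    i          ≡⟨ sym (m*n/n≡m i u) ⟩
    i * u / u  ≤⟨ /-monoˡ-≤ u (≤-trans (≤-reflexive (*-comm i u)) ui≤d) ⟩
    d / u      ∎
  where open ≤-Reasoning

record Profile (u d : ℕ) {n : ℕ} (c : Vecℕ n) : Set where
  field
    level     : ℕ
    spread    : Vecℕ n
    level-ok  : u * level ≤ d
    spread-wt : wt spread ≡ d ∸ u * level
    shape     : ∀ k → c k ≡ level + spread k

K-profile : ∀ r n a d {x} → K r n a d x →
            Σ (Vecℕ n) λ c → Profile (suc (n ∸ r)) d c × (∀ k → x k ≤ a k + c k)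
K-profile r n a d (i , i≤ , b , (ε , ε-wt , b≡) , x≺b) =
  (λ k → i + ε k) ,
  record { level = i ; spread = ε ; level-ok = ≤/⇒*≤ i d (suc (n ∸ r)) i≤
         ; spread-wt = ε-wt ; shape = λ k → refl } ,
  λ k → ≤-trans (x≺b k) (≤-reflexive (trans (b≡ k) (+-assoc (a k) i (ε k))))

profile-K : ∀ r n a d {x c} → Profile (suc (n ∸ r)) d c → (∀ k → x k ≤ a k + c k) → K r n a d x
profile-K r n a d P x≤ =
  level , *≤⇒≤/ level d (suc (n ∸ r)) level-ok ,
  (λ k → a k + level + spread k) , (spread , spread-wt , λ k → refl) ,
  λ k → ≤-trans (x≤ k) (≤-reflexive (trans (cong (a k +_) (shape k)) (sym (+-assoc (a k) level (spread k)))))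
  where open Profile P

-- Every entry of a profile is at most d (this needs u ≥ 1).
profile-entry≤ : ∀ {m d n} {c : Vecℕ n} → Profile (suc m) d c → ∀ k → c k ≤ d
profile-entry≤ {m} {d} {c = c} P k = begin
    c k                                  ≡⟨ shape k ⟩
    level + spread k                     ≤⟨ +-mono-≤ (m≤n*m level (suc m)) (≤-trans (entry≤wt spread k) (≤-reflexive spread-wt)) ⟩
    suc m * level + (d ∸ suc m * level)  ≡⟨ m+[n∸m]≡n level-ok ⟩
    d                                    ∎
  where open Profile P; open ≤-Reasoning

profile-sumOn≤ : ∀ {u d n} {c : Vecℕ n} → Profile u d c → (I : Subset n) → ∣ I ∣ ≤ u → sumOn I c ≤ d
profile-sumOn≤ {u} {d} {c = c} P I I≤u = begin
    sumOn I c                                         ≡⟨ sumOn-cong I (λ k _ → shape k) ⟩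
    sumOn I (λ k → level + spread k)                  ≡⟨ sumOn-+ I (λ _ → level) spread ⟩
    sumOn I (λ _ → level) + sumOn I spread            ≤⟨ +-mono-≤ (≤-trans (≤-reflexive (sumOn-const I level)) (*-monoˡ-≤ level I≤u))
                                                                  (≤-trans (sumOn≤wt I spread) (≤-reflexive spread-wt)) ⟩
    u * level + (d ∸ u * level)                       ≡⟨ m+[n∸m]≡n level-ok ⟩
    d                                                 ∎
  where open Profile P; open ≤-Reasoning

-- The multiplier bounding the contribution of t coordinates of one profile.
cap : ℕ → ℕ → ℕ
cap u t = t ⊓ suc (t ∸ u)

level-estimate : ∀ u t i d → u * i ≤ d → i ≤ d → t * i + (d ∸ u * i) ≤ suc (t ∸ u) * d
level-estimate u t i d ui≤d i≤d = begin
    t * i + (d ∸ u * i)                ≤⟨ +-monoˡ-≤ _ (*-monoˡ-≤ i (m≤n+m∸n t u)) ⟩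
    (u + e) * i + (d ∸ u * i)          ≡⟨ cong (_+ (d ∸ u * i)) (trans (*-distribʳ-+ i u e) (+-comm (u * i) (e * i))) ⟩
    e * i + u * i + (d ∸ u * i)        ≡⟨ +-assoc (e * i) (u * i) _ ⟩
    e * i + (u * i + (d ∸ u * i))      ≡⟨ cong (e * i +_) (m+[n∸m]≡n ui≤d) ⟩
    e * i + d                          ≤⟨ +-monoˡ-≤ d (*-monoʳ-≤ e i≤d) ⟩
    e * d + d                          ≡⟨ +-comm (e * d) d ⟩
    suc e * d                          ∎
  where
  open ≤-Reasoning
  e : ℕ
  e = t ∸ u

-- Key per-profile bound: for 0/1 weights w with t = |w|, Σ_k w_k c_k ≤ cap u t · d.
-- Either bound every entry by d, or use c = i·𝟏 + ε and the level estimate.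
profile-weighted≤ : ∀ {m d n} {c : Vecℕ n} → Profile (suc m) d c → (w : Vecℕ n) → (∀ k → w k ≤ 1) →
                    wt (λ k → w k * c k) ≤ cap (suc m) (wt w) * d
profile-weighted≤ {m} {d} {c = c} P w w≤1 =
  ≤-trans (⊓-glb by-entries by-level) (≤-reflexive (sym (*-distribʳ-⊓ d (wt w) (suc (wt w ∸ suc m)))))
  where
  open Profile P
  open ≤-Reasoning
  by-entries : wt (λ k → w k * c k) ≤ wt w * d
  by-entries = begin
    wt (λ k → w k * c k)  ≤⟨ wt-mono (λ k → *-monoʳ-≤ (w k) (profile-entry≤ P k)) ⟩
    wt (λ k → w k * d)    ≡⟨ wt-*ʳ w d ⟩
    wt w * d              ∎
  weighted-entry : ∀ k → w k * c k ≤ w k * level + spread k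
  weighted-entry k = begin
    w k * c k                       ≡⟨ cong (w k *_) (shape k) ⟩
    w k * (level + spread k)        ≡⟨ *-distribˡ-+ (w k) level (spread k) ⟩
    w k * level + w k * spread k    ≤⟨ +-monoʳ-≤ (w k * level) (≤-trans (*-monoˡ-≤ (spread k) (w≤1 k)) (≤-reflexive (*-identityˡ (spread k)))) ⟩
    w k * level + spread k          ∎
  by-level : wt (λ k → w k * c k) ≤ suc (wt w ∸ suc m) * d
  by-level = begin
    wt (λ k → w k * c k)                 ≤⟨ wt-mono weighted-entry ⟩
    wt (λ k → w k * level + spread k)    ≡⟨ wt-+ (λ k → w k * level) spread ⟩
    wt (λ k → w k * level) + wt spread   ≡⟨ cong₂ _+_ (wt-*ʳ w level) spread-wt ⟩
    wt w * level + (d ∸ suc m * level)   ≤⟨ level-estimate (suc m) (wt w) level d level-ok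
                                              (≤-trans (m≤n*m level (suc m)) level-ok) ⟩
    suc (wt w ∸ suc m) * d               ∎

-- If t_1 + … + t_r = m + r then the caps add up to at most r: at most one t_j can
-- reach u = m + 1, and such a t_j pays for the excess m of the total.
cap-sum≤ : ∀ {r} m (t : Fin r → ℕ) → wt t ≡ m + r → wt (λ j → cap (suc m) (t j)) ≤ r
cap-sum≤ {r} m t Σt with any? (λ j → suc m ≤? t j)
... | no no-large = begin
    wt (λ j → cap (suc m) (t j))  ≤⟨ wt-mono cap≤1 ⟩
    wt {r} (λ _ → 1)              ≡⟨ wt-const r 1 ⟩
    r * 1                         ≡⟨ *-identityʳ r ⟩
    r                             ∎
  where
  open ≤-Reasoning
  cap≤1 : ∀ j → cap (suc m) (t j) ≤ 1
  cap≤1 j = ≤-trans (m⊓n≤n (t j) _)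
                    (≤-reflexive (cong suc (m≤n⇒m∸n≡0 (<⇒≤ (≰⇒> (λ u≤t → no-large (j , u≤t)))))))
... | yes (j₀ , u≤t₀) = +-cancelˡ-≤ m _ _ (begin
    m + wt (λ j → cap (suc m) (t j))  ≡⟨ +-comm m _ ⟩
    wt (λ j → cap (suc m) (t j)) + m  ≤⟨ wt-mono-gap _ t j₀ m (λ j → m⊓n≤m (t j) _) gap ⟩
    wt t                              ≡⟨ Σt ⟩
    m + r                             ∎)
  where
  open ≤-Reasoning
  gap : cap (suc m) (t j₀) + m ≤ t j₀
  gap = begin
    cap (suc m) (t j₀) + m   ≤⟨ +-monoˡ-≤ m (m⊓n≤n (t j₀) _) ⟩
    suc (t j₀ ∸ suc m) + m   ≡⟨ sym (+-suc (t j₀ ∸ suc m) m) ⟩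
    t j₀ ∸ suc m + suc m     ≡⟨ m∸n+n≡m u≤t₀ ⟩
    t j₀                     ∎

profiles-assigned≤ : ∀ {r n} m d (c : Fin r → Vecℕ n) (own : Fin n → Fin r) →
                     (∀ j → Profile (suc m) d (c j)) → n ≡ m + r → wt (λ k → c (own k) k) ≤ r * d
profiles-assigned≤ {r} m d c own P n≡ = begin
    wt (λ k → c (own k) k)                       ≡⟨ wt-by-owner own c ⟩
    wt (λ j → wt (λ k → δ (own k) j * c j k))    ≤⟨ wt-mono (λ j → profile-weighted≤ (P j) (λ k → δ (own k) j) (λ k → δ≤1 (own k) j)) ⟩
    wt (λ j → cap (suc m) (owned j) * d)         ≡⟨ wt-*ʳ (λ j → cap (suc m) (owned j)) d ⟩
    wt (λ j → cap (suc m) (owned j)) * d         ≤⟨ *-monoˡ-≤ d (cap-sum≤ m owned (trans (owner-counts own) n≡)) ⟩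
    r * d                                        ∎
  where
  open ≤-Reasoning
  owned : Fin r → ℕ
  owned j = wt (λ k → δ (own k) j)

-- Top-u sums: topSum u y is the largest sum of at most u coordinates of y.

topSum : ℕ → ∀ {n} → Vecℕ n → ℕ
topSum zero    y = 0
topSum (suc u) {zero}  y = 0
topSum (suc u) {suc n} y = topSum (suc u) (tl y) ⊔ (y zero + topSum u (tl y))

isPos : ℕ → ℕ
isPos zero    = 0
isPos (suc _) = 1

supp : ∀ {n} → Vecℕ n → ℕ
supp y = wt (λ k → isPos (y k))

lower : ∀ {n} → Vecℕ n → Vecℕ n
lower y k = y k ∸ 1

isPos≤ : ∀ v → isPos v ≤ v
isPos≤ zero    = z≤n
isPos≤ (suc v) = s≤s z≤n

wt-lower : ∀ {n} (y : Vecℕ n) → wt (lower y) + supp y ≡ wt y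
wt-lower y = trans (sym (wt-+ (lower y) (λ k → isPos (y k)))) (wt-cong (λ k → lower+isPos (y k)))
  where
  lower+isPos : ∀ v → v ∸ 1 + isPos v ≡ v
  lower+isPos zero    = refl
  lower+isPos (suc v) = +-comm v 1

topSum≤wt : ∀ u {n} (y : Vecℕ n) → topSum u y ≤ wt y
topSum≤wt zero    y = z≤n
topSum≤wt (suc u) {zero}  y = z≤n
topSum≤wt (suc u) {suc n} y =
  ⊔-lub (≤-trans (topSum≤wt (suc u) (tl y)) (m≤n+m _ _)) (+-monoʳ-≤ (y zero) (topSum≤wt u (tl y)))

topSum-suc : ∀ u {n} (y : Vecℕ n) → topSum u y ≤ topSum (suc u) y
topSum-suc zero    y = z≤n
topSum-suc (suc u) {zero}  y = z≤n
topSum-suc (suc u) {suc n} y =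
  ⊔-lub (≤-trans (topSum-suc (suc u) (tl y)) (m≤m⊔n _ _))
        (≤-trans (+-monoʳ-≤ (y zero) (topSum-suc u (tl y))) (m≤n⊔m _ _))

wt≤topSum : ∀ u {n} (y : Vecℕ n) → supp y ≤ u → wt y ≤ topSum u y
wt≤topSum u {zero} y _ = z≤n
wt≤topSum zero {suc n} y h = head (y zero) h
  where
  head : ∀ y₀ → isPos y₀ + supp (tl y) ≤ 0 → y₀ + wt (tl y) ≤ 0
  head zero    h = wt≤topSum zero (tl y) h
  head (suc _) ()
wt≤topSum (suc u) {suc n} y h = head (y zero) h
  where
  head : ∀ y₀ → isPos y₀ + supp (tl y) ≤ suc u →
         y₀ + wt (tl y) ≤ topSum (suc u) (tl y) ⊔ (y₀ + topSum u (tl y))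
  head zero    h = ≤-trans (wt≤topSum (suc u) (tl y) h) (m≤m⊔n _ _)
  head (suc z) h = ≤-trans (+-monoʳ-≤ (suc z) (wt≤topSum u (tl y) (≤-pred h))) (m≤n⊔m _ _)

topSum-lower : ∀ u {n} (y : Vecℕ n) → u ≤ supp y → u + topSum u (lower y) ≤ topSum u y
topSum-lower zero    y h = z≤n
topSum-lower (suc u) {zero}  y ()
topSum-lower (suc u) {suc n} y h =
  ≤-trans (≤-reflexive (+-distribˡ-⊔ (suc u) _ _)) (⊔-lub (skip-head (y zero) h) (take-head (y zero) h))
  where
  ys : Vecℕ n
  ys = tl y
  goal : ℕ → ℕ
  goal y₀ = topSum (suc u) ys ⊔ (y₀ + topSum u ys)
  -- the optimal set for lower y avoids the head
  skip-head : ∀ y₀ → suc u ≤ isPos y₀ + supp ys → suc u + topSum (suc u) (lower ys) ≤ goal y₀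
  skip-head y₀ h with suc u ≤? supp ys
  ... | yes many = ≤-trans (topSum-lower (suc u) ys many) (m≤m⊔n _ _)
  ... | no few = begin
      suc u + topSum (suc u) (lower ys)  ≤⟨ +-mono-≤ (≤-trans h (+-monoˡ-≤ (supp ys) (isPos≤ y₀))) (topSum≤wt (suc u) (lower ys)) ⟩
      y₀ + supp ys + wt (lower ys)       ≡⟨ +-assoc y₀ (supp ys) _ ⟩
      y₀ + (supp ys + wt (lower ys))     ≡⟨ cong (y₀ +_) (trans (+-comm (supp ys) _) (wt-lower ys)) ⟩
      y₀ + wt ys                         ≤⟨ +-monoʳ-≤ y₀ (wt≤topSum u ys (≤-pred (≰⇒> few))) ⟩
      y₀ + topSum u ys                   ≤⟨ m≤n⊔m _ _ ⟩
      goal y₀                            ∎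
    where open ≤-Reasoning
  -- the optimal set for lower y contains the head
  take-head : ∀ y₀ → suc u ≤ isPos y₀ + supp ys → suc u + ((y₀ ∸ 1) + topSum u (lower ys)) ≤ goal y₀
  take-head zero h =
    ≤-trans (+-monoʳ-≤ (suc u) (topSum-suc u (lower ys))) (≤-trans (topSum-lower (suc u) ys h) (m≤m⊔n _ _))
  take-head (suc z) h = begin
      suc u + (z + topSum u (lower ys))  ≡⟨ cong suc (x∙yz≈y∙xz u z _) ⟩
      suc z + (u + topSum u (lower ys))  ≤⟨ +-monoʳ-≤ (suc z) (topSum-lower u ys (≤-pred h)) ⟩
      suc z + topSum u ys                ≤⟨ m≤n⊔m _ _ ⟩
      goal (suc z)                       ∎
    where open ≤-Reasoning

-- Well-founded recursion on d: either y has at most u nonzero entries (take i = 0),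
-- or peel one layer off y at the cost of u.
topSum⇒level : ∀ u {n} (y : Vecℕ n) d → 1 ≤ u → topSum u y ≤ d →
               Σ ℕ λ i → u * i + wt (λ k → y k ∸ i) ≤ d
topSum⇒level u {n} y d 1≤u = <-rec Goal step d y
  where
  Goal : ℕ → Set
  Goal d = (y : Vecℕ n) → topSum u y ≤ d → Σ ℕ λ i → u * i + wt (λ k → y k ∸ i) ≤ d
  step : ∀ d → (∀ {d'} → d' < d → Goal d') → Goal d
  step d rec y top≤d with supp y ≤? u
  ... | yes few = 0 , ≤-trans (≤-reflexive (cong (_+ wt y) (*-zeroʳ u))) (≤-trans (wt≤topSum u y few) top≤d)
  ... | no many = suc i , (begin
      u * suc i + wt (λ k → y k ∸ suc i)     ≡⟨ cong₂ _+_ (*-suc u i) (wt-cong (λ k → sym (∸-+-assoc (y k) 1 i))) ⟩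
      u + u * i + wt (λ k → lower y k ∸ i)   ≡⟨ +-assoc u _ _ ⟩
      u + (u * i + wt (λ k → lower y k ∸ i)) ≤⟨ +-monoʳ-≤ u (proj₂ lowered) ⟩
      u + (d ∸ u)                            ≡⟨ m+[n∸m]≡n u≤d ⟩
      d                                      ∎)
    where
    open ≤-Reasoning
    peeled : u + topSum u (lower y) ≤ d
    peeled = ≤-trans (topSum-lower u y (<⇒≤ (≰⇒> many))) top≤d
    u≤d : u ≤ d
    u≤d = ≤-trans (m≤m+n u _) peeled
    lowered : Σ ℕ λ i → u * i + wt (λ k → lower y k ∸ i) ≤ d ∸ u
    lowered = rec (∸-monoʳ-< 1≤u u≤d) (lower y) (m+n≤o⇒m≤o∸n _ (≤-trans (≤-reflexive (+-comm _ u)) peeled))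
    i : ℕ
    i = proj₁ lowered

topSet : ℕ → ∀ {n} → Vecℕ n → Subset n
topSet zero    y = ⊥
topSet (suc u) {zero}  y = []
topSet (suc u) {suc n} y with y zero + topSum u (tl y) ≤? topSum (suc u) (tl y)
... | yes _ = false ∷ topSet (suc u) (tl y)
... | no _  = true ∷ topSet u (tl y)

topSet-size : ∀ u {n} (y : Vecℕ n) → ∣ topSet u y ∣ ≤ u
topSet-size zero    {n} y = ≤-reflexive (∣⊥∣≡0 n)
topSet-size (suc u) {zero}  y = z≤n
topSet-size (suc u) {suc n} y with y zero + topSum u (tl y) ≤? topSum (suc u) (tl y)
... | yes _ = topSet-size (suc u) (tl y)
... | no _  = s≤s (topSet-size u (tl y))

topSet-sum : ∀ u {n} (y : Vecℕ n) → sumOn (topSet u y) y ≡ topSum u y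
topSet-sum zero    {n} y = sumOn-empty ⊥ y (∣⊥∣≡0 n)
topSet-sum (suc u) {zero}  y = refl
topSet-sum (suc u) {suc n} y with y zero + topSum u (tl y) ≤? topSum (suc u) (tl y)
... | yes skip = trans (topSet-sum (suc u) (tl y)) (sym (m≥n⇒m⊔n≡m skip))
... | no take  = trans (cong (y zero +_) (topSet-sum u (tl y))) (sym (m≤n⇒m⊔n≡n (<⇒≤ (≰⇒> take))))

topSet-pos : ∀ u {n} (y : Vecℕ n) k → lookup (topSet u y) k ≡ true → 0 < y k
topSet-pos zero y k k∈ = contradiction (trans (sym (lookup-replicate k false)) k∈) λ ()
topSet-pos (suc u) {suc n} y k k∈ with y zero + topSum u (tl y) ≤? topSum (suc u) (tl y)
topSet-pos (suc u) {suc n} y (suc k) k∈ | yes _   = topSet-pos (suc u) (tl y) k k∈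
topSet-pos (suc u) {suc n} y zero    _  | no take = head-pos (y zero) take (topSum-suc u (tl y))
  where
  head-pos : ∀ v {A B} → ¬ (v + A ≤ B) → A ≤ B → 0 < v
  head-pos zero    v+A≰B A≤B = contradiction A≤B v+A≰B
  head-pos (suc v) _       _   = s≤s z≤n
topSet-pos (suc u) {suc n} y (suc k) k∈ | no _    = topSet-pos u (tl y) k k∈

K⊆L : ∀ r n a d x → K r n a d x → L r n a d x
K⊆L r n a d x x∈K I _ I≤ = begin
    sumOn I x                             ≤⟨ sumOn-mono I x≤a+c ⟩
    sumOn I (λ k → a k + c k)             ≡⟨ sumOn-+ I a c ⟩
    sumOn I a + sumOn I c                 ≤⟨ +-monoʳ-≤ (sumOn I a) (profile-sumOn≤ P I (≤-trans I≤ (≤-reflexive (+-comm (n ∸ r) 1)))) ⟩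
    sumOn I a + d                         ∎
  where
  open ≤-Reasoning
  c : Vecℕ n
  c = proj₁ (K-profile r n a d x∈K)
  P : Profile (suc (n ∸ r)) d c
  P = proj₁ (proj₂ (K-profile r n a d x∈K))
  x≤a+c : ∀ k → x k ≤ a k + c k
  x≤a+c = proj₂ (proj₂ (K-profile r n a d x∈K))

-- The constraints of L bound the top-(n − r + 1) sum of the excess x ∸ a by d:
-- apply the constraint of L to the top set, on which x = a + (x ∸ a).
L⇒topSum≤ : ∀ r n a d x → L r n a d x → topSum (suc (n ∸ r)) (λ k → x k ∸ a k) ≤ d
L⇒topSum≤ r n a d x x∈L = by-size (∣ I ∣ ≟ 0)
  where
  u : ℕ
  u = suc (n ∸ r)
  y : Vecℕ n
  y k = x k ∸ a k
  I : Subset n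
  I = topSet u y
  open ≤-Reasoning
  by-size : Dec (∣ I ∣ ≡ 0) → topSum u y ≤ d
  by-size (yes empty) = ≤-trans (≤-reflexive (trans (sym (topSet-sum u y)) (sumOn-empty I y empty))) z≤n
  by-size (no nonempty) = +-cancelˡ-≤ (sumOn I a) _ _ (begin
    sumOn I a + topSum u y     ≡⟨ cong (sumOn I a +_) (sym (topSet-sum u y)) ⟩
    sumOn I a + sumOn I y      ≡⟨ sym (sumOn-+ I a y) ⟩
    sumOn I (λ k → a k + y k)  ≡⟨ sumOn-cong I (λ k k∈I → m+[n∸m]≡n {a k} (<⇒≤ (m∸n≢0⇒n<m (n>0⇒n≢0 (topSet-pos u y k k∈I))))) ⟩
    sumOn I x                  ≤⟨ x∈L I (n≢0⇒n>0 nonempty) (≤-trans (topSet-size u y) (≤-reflexive (+-comm 1 (n ∸ r)))) ⟩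
    sumOn I a + d              ∎)

-- A level i with u·i + |v| ≤ d extends to a profile above i·𝟏 + v by padding the
-- first coordinate, so that the spread has weight exactly d − u·i.
pad-profile : ∀ {n} u d i (v : Vecℕ (suc n)) → u * i + wt v ≤ d →
              Σ (Vecℕ (suc n)) λ c → Profile u d c × (∀ k → i + v k ≤ c k)
pad-profile {n} u d i v ≤d =
  (λ k → i + spread k) ,
  record { level = i ; spread = spread ; level-ok = ≤-trans (m≤m+n (u * i) _) ≤d
         ; spread-wt = spread-wt ; shape = λ k → refl } ,
  λ k → +-monoʳ-≤ i (m≤m+n (v k) _)
  where
  slack : ℕ
  slack = d ∸ u * i ∸ wt v
  spread : Vecℕ (suc n)
  spread k = v k + δ zero k * slack
  v≤ : wt v ≤ d ∸ u * i
  v≤ = m+n≤o⇒m≤o∸n (wt v) (≤-trans (≤-reflexive (+-comm (wt v) (u * i))) ≤d)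
  spread-wt : wt spread ≡ d ∸ u * i
  spread-wt = trans (wt-+ v (λ k → δ zero k * slack))
                    (trans (cong (wt v +_) (wt-δ {suc n} zero (λ _ → slack))) (m+[n∸m]≡n v≤))

L⊆K : ∀ r n' a d x → L r (suc n') a d x → K r (suc n') a d x
L⊆K r n' a d x x∈L = profile-K r (suc n') a d P x≤a+c
  where
  u : ℕ
  u = suc (suc n' ∸ r)
  y : Vecℕ (suc n')
  y k = x k ∸ a k
  found : Σ ℕ λ i → u * i + wt (λ k → y k ∸ i) ≤ d
  found = topSum⇒level u y d (s≤s z≤n) (L⇒topSum≤ r (suc n') a d x x∈L)
  i : ℕ
  i = proj₁ found
  padded : Σ (Vecℕ (suc n')) λ c → Profile u d c × (∀ k → i + (y k ∸ i) ≤ c k)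
  padded = pad-profile u d i (λ k → y k ∸ i) (proj₂ found)
  c : Vecℕ (suc n')
  c = proj₁ padded
  P : Profile u d c
  P = proj₁ (proj₂ padded)
  x≤a+c : ∀ k → x k ≤ a k + c k
  x≤a+c k = ≤-trans (m≤n+m∸n (x k) (a k))
              (+-monoʳ-≤ (a k) (≤-trans (m≤n+m∸n (y k) i) (proj₂ (proj₂ padded) k)))

K-union : ∀ r' n s d (a : Vecℕ n) → suc r' ≤ n → suc r' * d ≤ s → wt a ≡ s ∸ suc r' * d →
          RwiseSUnion (suc r') s (K (suc r') n a d)
K-union r' n s d a r≤n rd≤s a-wt f f∈K = begin
    wt (join f)                        ≤⟨ wt-mono join≤ ⟩
    wt (λ k → a k + c (own k) k)       ≡⟨ wt-+ a (λ k → c (own k) k) ⟩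
    wt a + wt (λ k → c (own k) k)      ≤⟨ +-monoʳ-≤ (wt a) (profiles-assigned≤ (n ∸ r) d c own P (sym (m∸n+n≡m r≤n))) ⟩
    wt a + r * d                       ≡⟨ cong (_+ r * d) a-wt ⟩
    s ∸ r * d + r * d                  ≡⟨ m∸n+n≡m rd≤s ⟩
    s                                  ∎
  where
  open ≤-Reasoning
  r : ℕ
  r = suc r'
  c : Fin r → Vecℕ n
  c j = proj₁ (K-profile r n a d (f∈K j))
  P : ∀ j → Profile (suc (n ∸ r)) d (c j)
  P j = proj₁ (proj₂ (K-profile r n a d (f∈K j)))
  own : Fin n → Fin r
  own k = proj₁ (argmax (λ j → c j k))
  join≤ : ∀ k → join f k ≤ a k + c (own k) k
  join≤ k = maxF-lub (λ j → f j k) _ λ j →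
    ≤-trans (proj₂ (proj₂ (K-profile r n a d (f∈K j))) k) (+-monoʳ-≤ (a k) (proj₂ (argmax (λ j → c j k)) j))

lemma1 : (r n s d : ℕ) → .{{_ : NonZero r}} → r ≤ n → d ≤ s / r →
         (a : Vecℕ n) → wt a ≡ s ∸ r * d →
         ((x : Vecℕ n) → (K r n a d x → L r n a d x) × (L r n a d x → K r n a d x))
         × RwiseSUnion r s (K r n a d)
lemma1 zero n s d _ _ _ _ = contradiction refl (≢-nonZero⁻¹ zero)
lemma1 (suc r') zero s d () _ _ _
lemma1 (suc r') (suc n') s d r≤n d≤s/r a a-wt =
  (λ x → K⊆L r n a d x , L⊆K r n' a d x) ,
  K-union r' n s d a r≤n (≤/⇒*≤ d s r d≤s/r) a-wt
  where
  r n : ℕ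
  r = suc r'
  n = suc n'
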